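{- Every 2-edge-colored triangular grid admits a homomorphism (of 2-edge-colored graphs) to the 2-edge-colored graph $\rho(SP_9^+)$.
   Context: A 2-edge-colored graph $G=(V,E,s)$ is a finite simple graph with a signature $s:E\to\{ -1,+1\}$. A homomorphism of 2-edge-colored graphs $G\to H$ is a map $\varphi:V(G)\to V(H)$ such that for every edge $uv$ of $G$, $\varphi(u)\varphi(v)$ is an edge of $H$ with $s_H(\varphi(u)\varphi(v))=s_G(uv)$ (no switching allowed). $SP_9$ is the 2-edge-colored complete graph with vertex set the finite field $\mathbb{F}_9$, where distinct $u,v$ are joined by a positive edge if $u-v$ is a square in $\mathbb{F}_9$ and by a negative edge otherwise. $SP_9^+$ is obtained from $SP_9$ by adding a new vertex $\infty$ joined by a positive edge to every vertex of $SP_9$. For a 2-edge-colored graph $H$ with signature $s_H$, the antitwinned graph $\rho(H)$ has vertex set $\{v^{i}: v\in V(H),\ i\in\{ -1,+1\}\}$, edge set $\{u^iv^j: uv\in E(H),\ i,j\in\{ -1,+1\}\}$, and signature $s_{\rho(H)}(u^iv^j)=i\cdot j\cdot s_H(uv)$. A triangular grid is a finite induced subgraph of the graph of the tiling of the plane by equilateral triangles; a 2-edge-colored triangular grid is such a graph with an arbitrary signature. -}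

module Defs where

open import Data.Integer using (ℤ; suc; pred)
open import Data.Product using (_×_; _,_; ∃)
open import Data.Maybe using (Maybe; just; nothing)
open import Data.Sign using (Sign) renaming (_*_ to _*ₛ_)
open import Relation.Binary.PropositionalEquality using (_≡_; _≢_)
open import Relation.Nullary using (¬_)

data F3 : Set where
  z0 z1 z2 : F3

_+₃_ : F3 → F3 → F3
z0 +₃ b = b
a +₃ z0 = a
z1 +₃ z1 = z2
z1 +₃ z2 = z0
z2 +₃ z1 = z0
z2 +₃ z2 = z1

-₃_ : F3 → F3
-₃ z0 = z0
-₃ z1 = z2
-₃ z2 = z1

_*₃_ : F3 → F3 → F3
z0 *₃ b = z0
z1 *₃ b = b
z2 *₃ b = -₃ b

-- The field F₉ = F₃[i] with i² = -1 (x² + 1 is irreducible over F₃).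
-- The pair (a , b) represents a + b·i.

F9 : Set
F9 = F3 × F3

_+₉_ : F9 → F9 → F9
(a , b) +₉ (c , d) = (a +₃ c , b +₃ d)

-₉_ : F9 → F9
-₉ (a , b) = (-₃ a , -₃ b)

_-₉_ : F9 → F9 → F9
x -₉ y = x +₉ (-₉ y)

_*₉_ : F9 → F9 → F9
(a , b) *₉ (c , d) = ((a *₃ c) +₃ (-₃ (b *₃ d)) , (a *₃ d) +₃ (b *₃ c))

IsSquare : F9 → Set
IsSquare x = ∃ λ y → y *₉ y ≡ x

-- SP₉⁺ : vertices F₉ ∪ {∞}  (∞ = nothing).  Complete graph.
-- SigSP u v s : uv is an edge of SP₉⁺ with sign s.

V⁺ : Set
V⁺ = Maybe F9

data SigSP : V⁺ → V⁺ → Sign → Set where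
  sq    : ∀ {u v} → u ≢ v → IsSquare (u -₉ v)   → SigSP (just u) (just v) Sign.+
  nsq   : ∀ {u v} → u ≢ v → ¬ IsSquare (u -₉ v) → SigSP (just u) (just v) Sign.-
  ∞-l   : ∀ {v} → SigSP nothing (just v) Sign.+
  ∞-r   : ∀ {u} → SigSP (just u) nothing Sign.+

Vρ : Set
Vρ = V⁺ × Sign

data SigRho : Vρ → Vρ → Sign → Set where
  edge : ∀ {u v i j t} → SigSP u v t → SigRho (u , i) (v , j) ((i *ₛ j) *ₛ t)

-- Triangular lattice in axial coordinates on ℤ²: (x,y) is adjacent to
-- (x±1,y), (x,y±1), (x+1,y-1), (x-1,y+1).

Point : Set
Point = ℤ × ℤ

data Adj : Point → Point → Set where
  a1 : ∀ x y → Adj (x , y) (suc x , y)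
  a2 : ∀ x y → Adj (x , y) (pred x , y)
  a3 : ∀ x y → Adj (x , y) (x , suc y)
  a4 : ∀ x y → Adj (x , y) (x , pred y)
  a5 : ∀ x y → Adj (x , y) (suc x , pred y)
  a6 : ∀ x y → Adj (x , y) (pred x , suc y)

-- Embed the grid in a triangle of ℕ² and map it row by row, each row resting on
-- the one below it.  A vertex of the new row must be a common neighbour, with
-- prescribed colours, of the two vertices beneath it, and consecutive vertices of
-- the row must be joined by an edge of prescribed colour.  A finite computation in
-- ρ(SP₉⁺) shows that such a set of common neighbours has at least two elements,
-- and that for every vertex e, all but at most one element of the next set has a
-- neighbour of the required colour in the current set minus e.  Walking along the
-- row therefore keeps all but one vertex of each set reachable, so the row can be
-- completed; its consecutive vertices then lie over distinct vertices of SP₉⁺,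
-- which is all the next row needs.
module Submission where

open import Defs
open import Data.Bool using (Bool; true; T; not; _∧_; _∨_)
open import Data.Bool.ListAction using (all; any)
open import Data.Bool.Properties using (T-∧; T-∨; T-≡)
open import Data.Empty using (⊥-elim)
open import Data.Integer as ℤ using (ℤ; ∣_∣)
import Data.Integer.Properties as ℤ
open import Data.List using (List; []; _∷_; map; filter; cartesianProduct)
open import Data.List.Extrema.Nat using (max; xs≤max)
open import Data.List.Membership.Propositional using (_∈_; find)
open import Data.List.Membership.Propositional.Properties
  using (∈-map⁺; ∈-cartesianProduct⁺; ∈-filter⁺; ∈-filter⁻)
import Data.List.Relation.Unary.All as All
open import Data.List.Relation.Unary.All.Properties using (all⁺)
open import Data.List.Relation.Unary.AllPairs as AllPairs using (AllPairs; []; _∷_)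
open import Data.List.Relation.Unary.Any using (here; there)
open import Data.List.Relation.Unary.Any.Properties using (any⁻)
open import Data.Maybe using (just; nothing)
open import Data.Maybe.Properties using (just-injective)
open import Data.Nat as ℕ using (ℕ; zero; suc; _≤_; _<_; z≤n; s≤s)
import Data.Nat.Properties as ℕ
open import Data.Product as Product using (Σ; ∃; _×_; _,_; proj₁; proj₂)
open import Data.Sign using (Sign; +; -) renaming (_*_ to _*ₛ_)
import Data.Sign.Properties as Sign
open import Data.Sum using (_⊎_; inj₁; inj₂; [_,_]′)
open import Function using (_∘_; id; _⇔_; mk⇔; Equivalence)
open import Level using (0ℓ)
open import Relation.Binary.Definitions using (DecidableEquality)
open import Relation.Binary.PropositionalEquality
  using (_≡_; _≢_; refl; sym; trans; cong; cong₂; subst; subst₂; ≢-sym; module ≡-Reasoning)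
open import Relation.Nullary using (Dec; yes; no; ¬?; _×-dec_)
open import Relation.Nullary.Decidable using (map′; isYes; T?; toWitness; toWitnessFalse)
open import Relation.Unary using (Pred; Decidable)

open Equivalence using (to; from)

_≟₃_ : DecidableEquality F3
z0 ≟₃ z0 = yes refl
z1 ≟₃ z1 = yes refl
z2 ≟₃ z2 = yes refl
z0 ≟₃ z1 = no λ ()
z0 ≟₃ z2 = no λ ()
z1 ≟₃ z0 = no λ ()
z1 ≟₃ z2 = no λ ()
z2 ≟₃ z0 = no λ ()
z2 ≟₃ z1 = no λ ()

_≟⁺_ : DecidableEquality V⁺
nothing ≟⁺ nothing = yes refl
nothing ≟⁺ just _ = no λ ()
just _ ≟⁺ nothing = no λ ()
just (a , b) ≟⁺ just (c , d) =
  map′ (λ { (refl , refl) → refl }) (λ { refl → refl , refl }) (a ≟₃ c ×-dec b ≟₃ d)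

_≟ρ_ : DecidableEquality Vρ
(u , i) ≟ρ (v , j) =
  map′ (λ { (refl , refl) → refl }) (λ { refl → refl , refl }) (u ≟⁺ v ×-dec i Sign.≟ j)

-- The quadratic character of F₉.  The value χ 0 = + is junk: edges join distinct vertices.
χ : F9 → Sign
χ (z0 , z0) = +
χ (z1 , z0) = +
χ (z2 , z0) = +
χ (z0 , z1) = +
χ (z0 , z2) = +
χ (z1 , z1) = -
χ (z1 , z2) = -
χ (z2 , z1) = -
χ (z2 , z2) = -

χ-square : ∀ y → χ (y *₉ y) ≡ +
χ-square (z0 , z0) = refl
χ-square (z0 , z1) = refl
χ-square (z0 , z2) = refl
χ-square (z1 , z0) = refl
χ-square (z1 , z1) = refl
χ-square (z1 , z2) = refl
χ-square (z2 , z0) = refl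
χ-square (z2 , z1) = refl
χ-square (z2 , z2) = refl

χ≡+⇒IsSquare : ∀ x → χ x ≡ + → IsSquare x
χ≡+⇒IsSquare (z0 , z0) _ = (z0 , z0) , refl
χ≡+⇒IsSquare (z1 , z0) _ = (z1 , z0) , refl
χ≡+⇒IsSquare (z2 , z0) _ = (z0 , z1) , refl
χ≡+⇒IsSquare (z0 , z1) _ = (z1 , z2) , refl
χ≡+⇒IsSquare (z0 , z2) _ = (z1 , z1) , refl
χ≡+⇒IsSquare (z1 , z1) ()
χ≡+⇒IsSquare (z1 , z2) ()
χ≡+⇒IsSquare (z2 , z1) ()
χ≡+⇒IsSquare (z2 , z2) ()

IsSquare⇒χ≡+ : ∀ {x} → IsSquare x → χ x ≡ +
IsSquare⇒χ≡+ (y , refl) = χ-square y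

-- −1 = i² is a square in F₉, which is why SP₉ is an undirected graph.
χ-neg : ∀ x → χ (-₉ x) ≡ χ x
χ-neg (z0 , z0) = refl
χ-neg (z0 , z1) = refl
χ-neg (z0 , z2) = refl
χ-neg (z1 , z0) = refl
χ-neg (z1 , z1) = refl
χ-neg (z1 , z2) = refl
χ-neg (z2 , z0) = refl
χ-neg (z2 , z1) = refl
χ-neg (z2 , z2) = refl

-₃[a-b]≡b-a : ∀ a b → -₃ (a +₃ (-₃ b)) ≡ b +₃ (-₃ a)
-₃[a-b]≡b-a z0 z0 = refl
-₃[a-b]≡b-a z0 z1 = refl
-₃[a-b]≡b-a z0 z2 = refl
-₃[a-b]≡b-a z1 z0 = refl
-₃[a-b]≡b-a z1 z1 = refl
-₃[a-b]≡b-a z1 z2 = refl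
-₃[a-b]≡b-a z2 z0 = refl
-₃[a-b]≡b-a z2 z1 = refl
-₃[a-b]≡b-a z2 z2 = refl

-₉[u-v]≡v-u : ∀ u v → -₉ (u -₉ v) ≡ v -₉ u
-₉[u-v]≡v-u (a , b) (c , d) = cong₂ _,_ (-₃[a-b]≡b-a a c) (-₃[a-b]≡b-a b d)

colour : V⁺ → V⁺ → Sign
colour (just u) (just v) = χ (u -₉ v)
colour _        _        = +

colour-sym : ∀ u v → colour u v ≡ colour v u
colour-sym (just u) (just v) = trans (sym (χ-neg (u -₉ v))) (cong χ (-₉[u-v]≡v-u u v))
colour-sym (just _) nothing  = refl
colour-sym nothing  (just _) = refl
colour-sym nothing  nothing  = refl

SigSP⇒colour : ∀ {u v s} → SigSP u v s → u ≢ v × colour u v ≡ s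
SigSP⇒colour (sq u≢v square) = u≢v ∘ just-injective , IsSquare⇒χ≡+ square
SigSP⇒colour {just u} {just v} (nsq u≢v nonsquare) = u≢v ∘ just-injective , χ≡-
  where
  χ≡- : χ (u -₉ v) ≡ -
  χ≡- with χ (u -₉ v) in eq
  ... | + = ⊥-elim (nonsquare (χ≡+⇒IsSquare _ eq))
  ... | - = refl
SigSP⇒colour ∞-l = (λ ()) , refl
SigSP⇒colour ∞-r = (λ ()) , refl

colour⇒SigSP : ∀ {u v} → u ≢ v → SigSP u v (colour u v)
colour⇒SigSP {nothing} {nothing} u≢v = ⊥-elim (u≢v refl)
colour⇒SigSP {nothing} {just _}  _   = ∞-l
colour⇒SigSP {just _}  {nothing} _   = ∞-r
colour⇒SigSP {just u}  {just v}  u≢v with χ (u -₉ v) in eq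
... | + = sq (u≢v ∘ cong just) (χ≡+⇒IsSquare _ eq)
... | - = nsq (u≢v ∘ cong just) λ square → +≢- (trans (sym (IsSquare⇒χ≡+ square)) eq)
  where
  +≢- : + ≢ -
  +≢- ()

SigRho⇔colour : ∀ {u k v i s} → SigRho (u , k) (v , i) s ⇔ (u ≢ v × k *ₛ i *ₛ colour u v ≡ s)
SigRho⇔colour {k = k} {i = i} = mk⇔
  (λ { (edge uv) → Product.map₂ (cong (k *ₛ i *ₛ_)) (SigSP⇒colour uv) })
  (λ (u≢v , eq) → subst (SigRho _ _) eq (edge (colour⇒SigSP u≢v)))

sigRho? : ∀ a b s → Dec (SigRho a b s)
sigRho? (u , k) (v , i) s =
  map′ (from SigRho⇔colour) (to SigRho⇔colour) (¬? (u ≟⁺ v) ×-dec k *ₛ i *ₛ colour u v Sign.≟ s)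

SigRho⇒≢ : ∀ {a b s} → SigRho a b s → proj₁ a ≢ proj₁ b
SigRho⇒≢ = proj₁ ∘ to SigRho⇔colour

SigRho-sym : ∀ {a b s} → SigRho a b s → SigRho b a s
SigRho-sym {u , k} {v , i} ab =
  let u≢v , eq = to SigRho⇔colour ab
  in from SigRho⇔colour (≢-sym u≢v , trans (cong₂ _*ₛ_ (Sign.*-comm i k) (colour-sym v u)) eq)

SigRho-antitwin : ∀ {w v i s} → SigRho w (v , i) s ⇔ SigRho w (v , +) (i *ₛ s)
SigRho-antitwin {w , k} {v} {i} {s} = mk⇔
  (λ wv → let w≢v , eq = to SigRho⇔colour wv in from SigRho⇔colour (w≢v , normalise eq))
  (λ wv → let w≢v , eq = to SigRho⇔colour wv in from SigRho⇔colour (w≢v , denormalise eq))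
  where
  open ≡-Reasoning
  c = colour w v
  cancel : ∀ x → i *ₛ (i *ₛ x) ≡ x
  cancel x = trans (sym (Sign.*-assoc i i x)) (cong (_*ₛ x) (Sign.s*s≡+ i))
  swap : i *ₛ (k *ₛ + *ₛ c) ≡ k *ₛ i *ₛ c
  swap = begin
    i *ₛ (k *ₛ + *ₛ c)  ≡⟨ cong (λ x → i *ₛ (x *ₛ c)) (Sign.*-identityʳ k) ⟩
    i *ₛ (k *ₛ c)       ≡⟨ Sign.*-assoc i k c ⟨
    i *ₛ k *ₛ c         ≡⟨ cong (_*ₛ c) (Sign.*-comm i k) ⟩
    k *ₛ i *ₛ c         ∎
  normalise : k *ₛ i *ₛ c ≡ s → k *ₛ + *ₛ c ≡ i *ₛ s
  normalise eq = trans (sym (cancel (k *ₛ + *ₛ c))) (cong (i *ₛ_) (trans swap eq))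
  denormalise : k *ₛ + *ₛ c ≡ i *ₛ s → k *ₛ i *ₛ c ≡ s
  denormalise eq = trans (sym swap) (trans (cong (i *ₛ_) eq) (cancel s))

CommonNeighbour : Vρ → Vρ → Sign → Sign → Pred Vρ 0ℓ
CommonNeighbour a b s t w = SigRho w a s × SigRho w b t

commonNeighbour? : ∀ a b s t → Decidable (CommonNeighbour a b s t)
commonNeighbour? a b s t w = sigRho? w a s ×-dec sigRho? w b t

-- Walks through a sequence of vertex sets

module _ {A : Set} where

  Nontrivial : Pred A 0ℓ → Set
  Nontrivial P = ∀ e → ∃ λ w → P w × w ≢ e

  CoverAvoiding : Pred A 0ℓ → (A → A → Set) → Pred A 0ℓ → A → Set
  CoverAvoiding P R Q e = ∃ λ e′ → ∀ {w} → Q w → w ≢ e′ → ∃ λ u → P u × u ≢ e × R u w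

  RobustCover : Pred A 0ℓ → (A → A → Set) → Pred A 0ℓ → Set
  RobustCover P R Q = ∀ e → CoverAvoiding P R Q e

  robustCover-fromMembers : ∀ {P Q : Pred A 0ℓ} {R} → Decidable P → Nontrivial P →
                            (∀ {e} → P e → CoverAvoiding P R Q e) → RobustCover P R Q
  robustCover-fromMembers {P} P? nontrivial cover e with P? e
  ... | yes Pe = cover Pe
  ... | no ¬Pe =
    let e₀ , Pe₀ , _ = nontrivial e
        e′ , covered = cover Pe₀
    in e′ , λ Qw w≢e′ → let u , Pu , _ , Ruw = covered Qw w≢e′
                        in u , Pu , (λ u≡e → ¬Pe (subst P u≡e Pu)) , Ruw

module _ {A : Set} (C : ℕ → Pred A 0ℓ) (R : ℕ → A → A → Set) where

  Walk : ℕ → (ℕ → A) → Set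
  Walk n f = (∀ {x} → x ≤ n → C x (f x)) × (∀ {x} → x < n → R x (f x) (f (suc x)))

  private
    extend : (ℕ → A) → ℕ → A → ℕ → A
    extend f n w x with x ℕ.≤? n
    ... | yes _ = f x
    ... | no  _ = w

    extend-≤ : ∀ {f n w x} → x ≤ n → extend f n w x ≡ f x
    extend-≤ {n = n} {x = x} x≤n with x ℕ.≤? n
    ... | yes _   = refl
    ... | no  x≰n = ⊥-elim (x≰n x≤n)

    extend-suc : ∀ {f n w} → extend f n w (suc n) ≡ w
    extend-suc {n = n} with suc n ℕ.≤? n
    ... | yes n<n = ⊥-elim (ℕ.n≮n n n<n)
    ... | no  _   = refl

  Walk-extend : ∀ {n f w} → Walk n f → C (suc n) w → R n (f n) w →
                ∃ λ g → Walk (suc n) g × g (suc n) ≡ w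
  Walk-extend {n} {f} {w} (fC , fR) Cw Rw = g , (gC , gR) , g-new
    where
    g : ℕ → A
    g = extend f n w
    g-old : ∀ {x} → x ≤ n → g x ≡ f x
    g-old = extend-≤ {f} {n} {w}
    g-new : g (suc n) ≡ w
    g-new = extend-suc {f} {n} {w}
    gC : ∀ {x} → x ≤ suc n → C x (g x)
    gC {x} x≤1+n with ℕ.m≤n⇒m<n∨m≡n x≤1+n
    ... | inj₁ (s≤s x≤n) = subst (C x) (sym (g-old x≤n)) (fC x≤n)
    ... | inj₂ refl      = subst (C (suc n)) (sym g-new) Cw
    gR : ∀ {x} → x < suc n → R x (g x) (g (suc x))
    gR {x} (s≤s x≤n) with ℕ.m≤n⇒m<n∨m≡n x≤n
    ... | inj₁ x<n  rewrite g-old (ℕ.<⇒≤ x<n) | g-old x<n = fR x<n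
    ... | inj₂ refl rewrite g-old (ℕ.≤-refl {n}) | g-new = Rw

  reachable-but-one : A → ∀ n → (∀ {x} → x < n → RobustCover (C x) (R x) (C (suc x))) →
                      ∃ λ e → ∀ {w} → C n w → w ≢ e → ∃ λ f → Walk n f × f n ≡ w
  reachable-but-one a zero _ = a , λ {w} Cw _ → (λ _ → w) , ((λ { z≤n → Cw }) , λ ()) , refl
  reachable-but-one a (suc n) cover =
    let e , reached = reachable-but-one a n (λ x<n → cover (ℕ.m<n⇒m<1+n x<n))
        e′ , covered = cover (ℕ.n<1+n n) e
    in e′ , λ Cw w≢e′ →
         let u , Cu , u≢e , Ruw = covered Cw w≢e′
             f , fwalk , fn≡u = reached Cu u≢e
         in Walk-extend fwalk Cw (subst (λ v → R n v _) (sym fn≡u) Ruw)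

  walk-exists : A → ∀ n → Nontrivial (C n) →
                (∀ {x} → x < n → RobustCover (C x) (R x) (C (suc x))) → ∃ (Walk n)
  walk-exists a n nontrivial cover =
    let e , reached = reachable-but-one a n cover
        w , Cw , w≢e = nontrivial e
        f , fwalk , _ = reached Cw w≢e
    in f , fwalk

-- Two finite facts about ρ(SP₉⁺), checked by computation

-- Opaque, so that elaboration never unfolds these enumerations; only the two
-- closed checks below compute with them.
opaque
  allF3 : List F3
  allF3 = z0 ∷ z1 ∷ z2 ∷ []

  ∈-allF3 : ∀ a → a ∈ allF3
  ∈-allF3 z0 = here refl
  ∈-allF3 z1 = there (here refl)
  ∈-allF3 z2 = there (there (here refl))

  allV⁺ : List V⁺
  allV⁺ = nothing ∷ map just (cartesianProduct allF3 allF3)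

  ∈-allV⁺ : ∀ v → v ∈ allV⁺
  ∈-allV⁺ nothing        = here refl
  ∈-allV⁺ (just (a , b)) = there (∈-map⁺ just (∈-cartesianProduct⁺ (∈-allF3 a) (∈-allF3 b)))

  signs : List Sign
  signs = + ∷ - ∷ []

  ∈-signs : ∀ s → s ∈ signs
  ∈-signs + = here refl
  ∈-signs - = there (here refl)

  allVρ : List Vρ
  allVρ = cartesianProduct allV⁺ signs

  ∈-allVρ : ∀ w → w ∈ allVρ
  ∈-allVρ (v , s) = ∈-cartesianProduct⁺ (∈-allV⁺ v) (∈-signs s)

module _ {A : Set} where

  T-all : ∀ {p : A → Bool} {xs x} → x ∈ xs → T (all p xs) → T (p x)
  T-all {p} {xs} x∈xs h = All.lookup (all⁺ p xs h) x∈xs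

  allPairsᵇ : (A → A → Bool) → List A → Bool
  allPairsᵇ p []       = true
  allPairsᵇ p (x ∷ xs) = all (p x) xs ∧ allPairsᵇ p xs

  allPairsᵇ⁺ : ∀ {p xs} → T (allPairsᵇ p xs) → AllPairs (λ x y → T (p x y)) xs
  allPairsᵇ⁺ {xs = []}     _ = []
  allPairsᵇ⁺ {p} {x ∷ xs} h =
    let hx , hxs = to (T-∧ {all (p x) xs}) h in all⁺ (p x) xs hx ∷ allPairsᵇ⁺ hxs

  all-but-one : ∀ {P : Pred A 0ℓ} → Decidable P → A → ∀ {xs} →
                AllPairs (λ x y → P x ⊎ P y) xs → ∃ λ e → ∀ {x} → x ∈ xs → x ≢ e → P x
  all-but-one P? d [] = d , λ ()
  all-but-one P? d {x ∷ _} (Px⊎ ∷ pairs) with P? x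
  ... | yes Px = let e , rest = all-but-one P? d pairs
                 in e , λ { (here refl) _ → Px ; (there y∈xs) y≢e → rest y∈xs y≢e }
  ... | no ¬Px = x , λ { (here refl) x≢x → ⊥-elim (x≢x refl)
                       ; (there y∈xs) _ → [ ⊥-elim ∘ ¬Px , id ]′ (All.lookup Px⊎ y∈xs) }

unless-≡ : ∀ {u v b} → u ≢ v → T (isYes (u ≟⁺ v) ∨ b) → T b
unless-≡ {u} {v} u≢v h with to (T-∨ {isYes (u ≟⁺ v)}) h
... | inj₁ u≡v = ⊥-elim (u≢v (toWitness u≡v))
... | inj₂ hb  = hb

-- Only the common neighbours of u⁺ and v⁺ are enumerated: those of u^i and v^j
-- follow by SigRho-antitwin.
commonNeighbours : V⁺ → V⁺ → Sign → Sign → List Vρ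
commonNeighbours u v s t = filter (commonNeighbour? (u , +) (v , +) s t) allVρ

∈-commonNeighbours : ∀ {u i v j s t w} →
  CommonNeighbour (u , i) (v , j) s t w ⇔ w ∈ commonNeighbours u v (i *ₛ s) (j *ₛ t)
∈-commonNeighbours {u} {i} {v} {j} {s} {t} {w} = mk⇔
  (λ cn → ∈-filter⁺ P? (∈-allVρ w) (Product.map (to SigRho-antitwin) (to SigRho-antitwin) cn))
  (λ w∈ → Product.map (from SigRho-antitwin) (from SigRho-antitwin)
            (proj₂ (∈-filter⁻ P? {xs = allVρ} w∈)))
  where
  P? = commonNeighbour? (u , +) (v , +) (i *ₛ s) (j *ₛ t)

avoidsᵇ : List Vρ → Vρ → Bool
avoidsᵇ N e = any (λ w → not (isYes (w ≟ρ e))) N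

avoidsᵇ-sound : ∀ {N e} → T (avoidsᵇ N e) → ∃ λ w → w ∈ N × w ≢ e
avoidsᵇ-sound {N} h =
  let w , w∈N , w≢e = find (any⁻ _ N h) in w , w∈N , toWitnessFalse w≢e

coversᵇ : List Vρ → Sign → Vρ → Vρ → Bool
coversᵇ N r e w = any (λ u → not (isYes (u ≟ρ e)) ∧ isYes (sigRho? u w r)) N

coversᵇ-sound : ∀ {N r e w} → T (coversᵇ N r e w) → ∃ λ u → u ∈ N × u ≢ e × SigRho u w r
coversᵇ-sound {N} h =
  let u , u∈N , hu = find (any⁻ _ N h)
      u≢e , uw = to (T-∧ {not (isYes (u ≟ρ _))}) hu
  in u , u∈N , toWitnessFalse u≢e , toWitness uw

robustᵇ : List Vρ → List Vρ → Sign → Bool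
robustᵇ N N′ r = all (λ e → allPairsᵇ (λ w₁ w₂ → coversᵇ N r e w₁ ∨ coversᵇ N r e w₂) N′) N

robustᵇ-sound : ∀ {N N′ r e} → T (robustᵇ N N′ r) → e ∈ N →
  ∃ λ e′ → ∀ {w} → w ∈ N′ → w ≢ e′ → ∃ λ u → u ∈ N × u ≢ e × SigRho u w r
robustᵇ-sound {N} {N′} {r} {e} h e∈N =
  let pairs = AllPairs.map (λ {w₁} → to (T-∨ {coversᵇ N r e w₁})) (allPairsᵇ⁺ (T-all e∈N h))
      e′ , covered = all-but-one (T? ∘ coversᵇ N r e) e pairs
  in e′ , λ w∈N′ w≢e′ → coversᵇ-sound (covered w∈N′ w≢e′)

opaque
  unfolding allVρ

  nontrivial-check : all (λ u → all (λ v → isYes (u ≟⁺ v) ∨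
    all (λ s → all (λ t → all (avoidsᵇ (commonNeighbours u v s t)) allVρ) signs) signs) allV⁺) allV⁺
    ≡ true
  nontrivial-check = refl

  robust-check : all (λ u → all (λ v → all (λ w → isYes (u ≟⁺ v) ∨ isYes (v ≟⁺ w) ∨
    all (λ s → all (λ t → all (λ s′ → all (λ t′ → all (λ r →
      robustᵇ (commonNeighbours u v s t) (commonNeighbours v w s′ t′) r)
    signs) signs) signs) signs) signs) allV⁺) allV⁺) allV⁺
    ≡ true
  robust-check = refl

nontrivial-checked : ∀ {u v} → u ≢ v → ∀ s t e → T (avoidsᵇ (commonNeighbours u v s t) e)
nontrivial-checked {u} {v} u≢v s t e =
  T-all (∈-allVρ e) (T-all (∈-signs t) (T-all (∈-signs s)
    (unless-≡ u≢v (T-all (∈-allV⁺ v) (T-all (∈-allV⁺ u) (from T-≡ nontrivial-check))))))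

robust-checked : ∀ {u v w} → u ≢ v → v ≢ w → ∀ s t s′ t′ r →
  T (robustᵇ (commonNeighbours u v s t) (commonNeighbours v w s′ t′) r)
robust-checked {u} {v} {w} u≢v v≢w s t s′ t′ r =
  T-all (∈-signs r) (T-all (∈-signs t′) (T-all (∈-signs s′) (T-all (∈-signs t) (T-all (∈-signs s)
    (unless-≡ v≢w (unless-≡ u≢v
      (T-all (∈-allV⁺ w) (T-all (∈-allV⁺ v) (T-all (∈-allV⁺ u) (from T-≡ robust-check))))))))))

commonNeighbour-nontrivial : ∀ {a b s t} → proj₁ a ≢ proj₁ b → Nontrivial (CommonNeighbour a b s t)
commonNeighbour-nontrivial {u , i} {v , j} {s} {t} u≢v e =
  let w , w∈N , w≢e = avoidsᵇ-sound (nontrivial-checked u≢v (i *ₛ s) (j *ₛ t) e)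
  in w , from ∈-commonNeighbours w∈N , w≢e

commonNeighbour-robust : ∀ {a b c s t s′ t′ r} → proj₁ a ≢ proj₁ b → proj₁ b ≢ proj₁ c →
  RobustCover (CommonNeighbour a b s t) (λ u w → SigRho u w r) (CommonNeighbour b c s′ t′)
commonNeighbour-robust {u , i} {v , j} {w , l} {s} {t} {s′} {t′} {r} u≢v v≢w =
  robustCover-fromMembers (commonNeighbour? _ _ s t) (commonNeighbour-nontrivial u≢v) cover
  where
  cover : ∀ {e} → CommonNeighbour (u , i) (v , j) s t e →
          CoverAvoiding (CommonNeighbour (u , i) (v , j) s t) (λ u w → SigRho u w r)
                        (CommonNeighbour (v , j) (w , l) s′ t′) e
  cover cn =
    let e′ , covered = robustᵇ-sound (robust-checked u≢v v≢w (i *ₛ s) (j *ₛ t) (j *ₛ s′) (l *ₛ t′) r)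
                                     (to ∈-commonNeighbours cn)
    in e′ , λ cn′ x≢e′ → let y , y∈N , y≢e , yx = covered (to ∈-commonNeighbours cn′) x≢e′
                         in y , from ∈-commonNeighbours y∈N , y≢e , yx

-- Triangles of the lattice ℕ²

Separated : ℕ → (ℕ → Vρ) → Set
Separated n f = ∀ {x} → x < n → proj₁ (f x) ≢ proj₁ (f (suc x))

Signature : Set
Signature = ℕ × ℕ → ℕ × ℕ → Sign

module _ (τ : Signature) (f : ℕ → Vρ) where

  Above : ℕ → Vρ → Set
  Above x = CommonNeighbour (f x) (f (suc x)) (τ (x , 1) (x , 0)) (τ (x , 1) (suc x , 0))

  Across : ℕ → Vρ → Vρ → Set
  Across x u w = SigRho u w (τ (x , 1) (suc x , 1))

  rowAbove : ∀ n → Separated (suc n) f → ∃ (Walk Above Across n)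
  rowAbove n sep =
    walk-exists Above Across (nothing , +) n
      (commonNeighbour-nontrivial (sep (ℕ.n<1+n n)))
      (λ x<n → commonNeighbour-robust (sep (ℕ.m<n⇒m<1+n x<n)) (sep (s≤s x<n)))

  rowAbove-separated : ∀ {n g} → Walk Above Across n g → Separated n g
  rowAbove-separated (_ , across) = SigRho⇒≢ ∘ across

raise : Signature → Signature
raise τ (x , y) (x′ , y′) = τ (x , suc y) (x′ , suc y′)

-- The clause for zero is junk: the triangle of size 0 has no vertex above row 0.
tower : ∀ n → Signature → (f : ℕ → Vρ) → Separated n f → ℕ × ℕ → Vρ
tower n       τ f sep (x , zero)  = f x
tower zero    τ f sep (x , suc y) = f x
tower (suc n) τ f sep (x , suc y) =
  let g , gwalk = rowAbove τ f n sep
  in tower n (raise τ) g (rowAbove-separated τ f gwalk) (x , y)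

-- Each edge of the triangular lattice on ℕ² that does not lie in row 0, in one orientation.
data Edge : ℕ × ℕ → ℕ × ℕ → Set where
  right : ∀ {x y} → Edge (x , suc y) (suc x , suc y)
  down  : ∀ {x y} → Edge (x , suc y) (x , y)
  diag  : ∀ {x y} → Edge (x , suc y) (suc x , y)

InTriangle : ℕ → ℕ × ℕ → Set
InTriangle n (x , y) = y ℕ.+ x ≤ n

tower-hom : ∀ n τ f (sep : Separated n f) {P Q} → Edge P Q → InTriangle n P → InTriangle n Q →
            SigRho (tower n τ f sep P) (tower n τ f sep Q) (τ P Q)
tower-hom zero    τ f sep right () _
tower-hom zero    τ f sep down  () _
tower-hom zero    τ f sep diag  () _
tower-hom (suc n) τ f sep = hom
  where
  g : ℕ → Vρ
  g = proj₁ (rowAbove τ f n sep)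
  gwalk : Walk (Above τ f) (Across τ f) n g
  gwalk = proj₂ (rowAbove τ f n sep)
  hom : ∀ {P Q} → Edge P Q → InTriangle (suc n) P → InTriangle (suc n) Q →
        SigRho (tower (suc n) τ f sep P) (tower (suc n) τ f sep Q) (τ P Q)
  hom (right {y = zero})  _         (s≤s x<n) = proj₂ gwalk x<n
  hom (down  {y = zero})  (s≤s x≤n) _         = proj₁ (proj₁ gwalk x≤n)
  hom (diag  {y = zero})  (s≤s x≤n) _         = proj₂ (proj₁ gwalk x≤n)
  hom (right {y = suc _}) (s≤s p)   (s≤s q)   = tower-hom n (raise τ) g _ right p q
  hom (down  {y = suc _}) (s≤s p)   (s≤s q)   = tower-hom n (raise τ) g _ down  p q
  hom (diag  {y = suc _}) (s≤s p)   (s≤s q)   = tower-hom n (raise τ) g _ diag  p q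

zigzag : ℕ → Vρ
zigzag zero          = nothing , +
zigzag (suc zero)    = just (z0 , z0) , +
zigzag (suc (suc x)) = zigzag x

zigzag-separated : ∀ {n} → Separated n zigzag
zigzag-separated {x = x} _ = alternates x
  where
  alternates : ∀ x → proj₁ (zigzag x) ≢ proj₁ (zigzag (suc x))
  alternates zero          ()
  alternates (suc zero)    ()
  alternates (suc (suc x)) = alternates x

-- From ℤ² to ℕ²

module Embedding (B : ℕ) where

  toℕ : ℤ → ℕ
  toℕ z = ∣ z ℤ.+ ℤ.+ B ∣

  fromℕ : ℕ → ℤ
  fromℕ n = ℤ.+ n ℤ.- ℤ.+ B

  +toℕ : ∀ z → ∣ z ∣ ≤ B → ℤ.+ toℕ z ≡ z ℤ.+ ℤ.+ B
  +toℕ (ℤ.+ n)      _ = refl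
  +toℕ (ℤ.-[1+ n ]) h rewrite ℤ.⊖-≥ h = refl

  fromℕ-toℕ : ∀ z → ∣ z ∣ ≤ B → fromℕ (toℕ z) ≡ z
  fromℕ-toℕ z h = begin
    ℤ.+ toℕ z ℤ.- ℤ.+ B           ≡⟨ cong (ℤ._- ℤ.+ B) (+toℕ z h) ⟩
    z ℤ.+ ℤ.+ B ℤ.- ℤ.+ B          ≡⟨ ℤ.+-assoc z (ℤ.+ B) (ℤ.- ℤ.+ B) ⟩
    z ℤ.+ (ℤ.+ B ℤ.- ℤ.+ B)        ≡⟨ cong (ℤ._+_ z) (ℤ.+-inverseʳ (ℤ.+ B)) ⟩
    z ℤ.+ ℤ.0ℤ                     ≡⟨ ℤ.+-identityʳ z ⟩
    z                              ∎
    where open ≡-Reasoning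

  toℕ-suc : ∀ z → ∣ z ∣ ≤ B → toℕ (ℤ.suc z) ≡ suc (toℕ z)
  toℕ-suc z h = cong ∣_∣ (begin
    ℤ.suc z ℤ.+ ℤ.+ B        ≡⟨ ℤ.+-assoc ℤ.1ℤ z (ℤ.+ B) ⟩
    ℤ.1ℤ ℤ.+ (z ℤ.+ ℤ.+ B)   ≡⟨ cong (ℤ._+_ ℤ.1ℤ) (+toℕ z h) ⟨
    ℤ.+ suc (toℕ z)          ∎)
    where open ≡-Reasoning

  toℕ-pred : ∀ z → ∣ ℤ.pred z ∣ ≤ B → toℕ z ≡ suc (toℕ (ℤ.pred z))
  toℕ-pred z h = trans (cong toℕ (sym (ℤ.suc-pred z))) (toℕ-suc (ℤ.pred z) h)

  toℕ-≤ : ∀ z → ∣ z ∣ ≤ B → toℕ z ≤ B ℕ.+ B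
  toℕ-≤ z h = ℕ.≤-trans (ℤ.∣i+j∣≤∣i∣+∣j∣ z (ℤ.+ B)) (ℕ.+-monoˡ-≤ B h)

  InRange : Point → Set
  InRange (x , y) = ∣ x ∣ ≤ B × ∣ y ∣ ≤ B

  side : ℕ
  side = suc ((B ℕ.+ B) ℕ.+ (B ℕ.+ B))

  -- Row 0 of the triangle is an auxiliary row below the image of the grid.
  embed : Point → ℕ × ℕ
  embed (x , y) = toℕ x , suc (toℕ y)

  unembed : ℕ × ℕ → Point
  unembed (X , Y) = fromℕ X , fromℕ (ℕ.pred Y)

  unembed-embed : ∀ p → InRange p → unembed (embed p) ≡ p
  unembed-embed (x , y) (hx , hy) = cong₂ _,_ (fromℕ-toℕ x hx) (fromℕ-toℕ y hy)

  embed-InTriangle : ∀ p → InRange p → InTriangle side (embed p)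
  embed-InTriangle (x , y) (hx , hy) = s≤s (ℕ.+-mono-≤ (toℕ-≤ y hy) (toℕ-≤ x hx))

  Adj⇒Edge : ∀ {p q} → InRange p → InRange q → Adj p q →
             Edge (embed p) (embed q) ⊎ Edge (embed q) (embed p)
  Adj⇒Edge (hx , _)  _          (a1 x y) =
    inj₁ (subst₂ Edge refl (cong₂ _,_ (sym (toℕ-suc x hx)) refl) right)
  Adj⇒Edge _         (hx′ , _)  (a2 x y) =
    inj₂ (subst₂ Edge refl (cong₂ _,_ (sym (toℕ-pred x hx′)) refl) right)
  Adj⇒Edge (_ , hy)  _          (a3 x y) =
    inj₂ (subst₂ Edge (cong₂ _,_ refl (cong suc (sym (toℕ-suc y hy)))) refl down)
  Adj⇒Edge _         (_ , hy′)  (a4 x y) =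
    inj₁ (subst₂ Edge (cong₂ _,_ refl (cong suc (sym (toℕ-pred y hy′)))) refl down)
  Adj⇒Edge (hx , _)  (_ , hy′)  (a5 x y) =
    inj₁ (subst₂ Edge (cong₂ _,_ refl (cong suc (sym (toℕ-pred y hy′))))
                      (cong₂ _,_ (sym (toℕ-suc x hx)) refl) diag)
  Adj⇒Edge (_ , hy)  (hx′ , _)  (a6 x y) =
    inj₂ (subst₂ Edge (cong₂ _,_ refl (cong suc (sym (toℕ-suc y hy))))
                      (cong₂ _,_ (sym (toℕ-pred x hx′)) refl) diag)

size : Point → ℕ
size (x , y) = ∣ x ∣ ℕ.⊔ ∣ y ∣

radius : List Point → ℕ
radius S = max 0 (map size S)

∈⇒InRange : ∀ {S p} → p ∈ S → Embedding.InRange (radius S) p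
∈⇒InRange {S} {x , y} p∈S =
  let size≤radius = All.lookup (xs≤max 0 (map size S)) (∈-map⁺ size p∈S)
  in ℕ.≤-trans (ℕ.m≤m⊔n ∣ x ∣ ∣ y ∣) size≤radius , ℕ.≤-trans (ℕ.m≤n⊔m ∣ x ∣ ∣ y ∣) size≤radius

lemma8 : (S : List Point) (σ : Point → Point → Sign)
    → (∀ {p q} → p ∈ S → q ∈ S → Adj p q → σ p q ≡ σ q p)
    → Σ (Point → Vρ) (λ φ → ∀ {p q} → p ∈ S → q ∈ S → Adj p q → SigRho (φ p) (φ q) (σ p q))
lemma8 S σ σ-sym = φ , hom
  where
  open Embedding (radius S)
  τ : Signature
  τ P Q = σ (unembed P) (unembed Q)
  φ : Point → Vρ
  φ p = tower side τ zigzag zigzag-separated (embed p)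
  edge-hom : ∀ {p q} → p ∈ S → q ∈ S → Edge (embed p) (embed q) → SigRho (φ p) (φ q) (σ p q)
  edge-hom {p} {q} p∈S q∈S pq =
    subst (SigRho (φ p) (φ q)) (cong₂ σ (unembed-embed p (∈⇒InRange p∈S)) (unembed-embed q (∈⇒InRange q∈S)))
      (tower-hom side τ zigzag zigzag-separated pq
        (embed-InTriangle p (∈⇒InRange p∈S)) (embed-InTriangle q (∈⇒InRange q∈S)))
  hom : ∀ {p q} → p ∈ S → q ∈ S → Adj p q → SigRho (φ p) (φ q) (σ p q)
  hom {p} {q} p∈S q∈S adj =
    [ edge-hom p∈S q∈S
    , (λ qp → subst (SigRho (φ p) (φ q)) (sym (σ-sym p∈S q∈S adj)) (SigRho-sym (edge-hom q∈S p∈S qp)))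
    ]′ (Adj⇒Edge (∈⇒InRange p∈S) (∈⇒InRange q∈S) adj)
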